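{- Let $V$ be a finite set, $d$ a nonnegative integer, and $f:2^V\to\{0,1,\dots,d\}$ a posimodular function with $f(\emptyset)=0$. Let $\mathcal{U}$ be the family of minimal unreachable sets of $f$. Then: (i) $1\le |U|\le d+1$ for all $U\in\mathcal{U}$; (ii) $|I|\le d$ for every subset $I\subseteq V$ that is independent of $\mathcal{U}$; (iii) if a singleton $\{u\}$ belongs to $\mathcal{U}$, then $f(\{u\})=0$, and hence $\{u\}$ minimizes $f$ over nonempty subsets of $V$.
   Context: A set function $f:2^V\to\mathbb{R}$ is posimodular if $f(X)+f(Y)\ge f(X\setminus Y)+f(Y\setminus X)$ for all $X,Y\subseteq V$. A subset $X\subseteq V$ with $k=|X|$ is reachable (from $\emptyset$) if there is a chain $\emptyset=X_0\subsetneq X_1\subsetneq\cdots\subsetneq X_k=X$ with $f(X_i)>f(X_{i-1})$ for all $i=1,\dots,k$; otherwise it is unreachable. An unreachable set is minimal unreachable if every proper subset of it is reachable. A subset $I\subseteq V$ is independent of $\mathcal{U}$ if it contains no member of $\mathcal{U}$. -}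

module Defs where

open import Data.Nat using (ℕ; zero; suc; _≤_; _<_)
open import Data.Fin using (Fin; fromℕ; inject₁)
open import Data.Fin.Subset using (Subset; ⊥; _⊂_; _⊆_; _─_; ∣_∣)
open import Data.Product using (Σ; ∃; _×_)
open import Relation.Binary.PropositionalEquality using (_≡_)
open import Relation.Nullary using (¬_)

Posimodular : ∀ {n} → (Subset n → ℕ) → Set
Posimodular f = ∀ X Y → f (X ─ Y) Data.Nat.+ f (Y ─ X) ≤ f X Data.Nat.+ f Y

record Chain {n} (f : Subset n → ℕ) (X : Subset n) : Set where
  field
    C      : Fin (suc ∣ X ∣) → Subset n
    start  : C (Data.Fin.zero) ≡ ⊥
    finish : C (fromℕ ∣ X ∣) ≡ X
    strict : ∀ (i : Fin ∣ X ∣) → C (inject₁ i) ⊂ C (Data.Fin.suc i)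
    incr   : ∀ (i : Fin ∣ X ∣) → f (C (inject₁ i)) < f (C (Data.Fin.suc i))

Reachable : ∀ {n} → (Subset n → ℕ) → Subset n → Set
Reachable f X = Chain f X

Unreachable : ∀ {n} → (Subset n → ℕ) → Subset n → Set
Unreachable f X = ¬ Reachable f X

MinimalUnreachable : ∀ {n} → (Subset n → ℕ) → Subset n → Set
MinimalUnreachable f U = Unreachable f U × (∀ Y → Y ⊂ U → Reachable f Y)

IndependentOfMU : ∀ {n} → (Subset n → ℕ) → Subset n → Set
IndependentOfMU f I = ∀ U → MinimalUnreachable f U → ¬ (U ⊆ I)

-- Along a chain witnessing reachability of X, f increases strictly at each of
-- the ∣X∣ steps, so ∣X∣ ≤ f X ≤ d. For (i), removing one element from a
-- minimal unreachable U leaves a reachable set. For (ii), every subset of an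
-- independent I is reachable by induction on its size: a smallest unreachable
-- subset of I would be a member of 𝒰 inside I. For (iii), ⁅u⁆ is reachable
-- as soon as f ⁅u⁆ > f ∅ = 0.
module Submission where

open import Defs
open import Data.Nat using (ℕ; zero; suc; _≤_; _<_; _+_; _≤?_; z≤n; s≤s)
open import Data.Nat.Properties using (≤-trans; ≤-refl; <-≤-trans; ≮⇒≥; n≤0⇒n≡0; +-comm; ≤-reflexive; m≤n⇒m≤1+n)
open import Data.Fin using (Fin; fromℕ; inject₁; toℕ)
open import Data.Fin.Properties using (toℕ-fromℕ)
open import Data.Fin.Subset
  using (Subset; ⊥; ⁅_⁆; ∣_∣; Nonempty; _∈_; _⊆_; _⊂_; _-_; inside; outside)
open import Data.Fin.Subset.Properties
  using ( ∣⊥∣≡0; ∣⁅x⁆∣≡1; p─⊥≡p; x∈⁅x⁆; ∉⊥; ⊆-refl; ⊆-trans; p⊂q⇒∣p∣<∣q∣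
        ; x∈p⇒p-x⊂p; x∈p⇒∣p-x∣<∣p∣; nonempty?; Empty-unique)
open import Data.Vec using ([]; _∷_)
open import Data.Product using (_×_; _,_; proj₁)
open import Data.Empty using (⊥-elim)
open import Function using (_∘_)
open import Relation.Nullary using (¬_; yes; no)
open import Relation.Nullary.Decidable using (decidable-stable)
open import Relation.Binary.PropositionalEquality using (_≡_; refl; sym; cong; subst; subst₂)

∣p∣≤1+∣p-x∣ : ∀ {n} (p : Subset n) x → ∣ p ∣ ≤ suc ∣ p - x ∣
∣p∣≤1+∣p-x∣ (inside  ∷ p) Fin.zero    = s≤s (≤-reflexive (cong ∣_∣ (sym (p─⊥≡p p))))
∣p∣≤1+∣p-x∣ (outside ∷ p) Fin.zero    = m≤n⇒m≤1+n (≤-reflexive (cong ∣_∣ (sym (p─⊥≡p p))))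
∣p∣≤1+∣p-x∣ (inside  ∷ p) (Fin.suc x) = s≤s (∣p∣≤1+∣p-x∣ p x)
∣p∣≤1+∣p-x∣ (outside ∷ p) (Fin.suc x) = ∣p∣≤1+∣p-x∣ p x

module _ {n : ℕ} {f : Subset n → ℕ} where

  -- Reachable f X fixes the chain length to ∣ X ∣, which need not reduce to a numeral.
  chain : ∀ {X} k → ∣ X ∣ ≡ k → (C : Fin (suc k) → Subset n)
        → C Fin.zero ≡ ⊥ → C (fromℕ k) ≡ X
        → (∀ i → C (inject₁ i) ⊂ C (Fin.suc i))
        → (∀ i → f (C (inject₁ i)) < f (C (Fin.suc i)))
        → Reachable f X
  chain _ refl C start finish strict incr = record
    { C = C ; start = start ; finish = finish ; strict = strict ; incr = incr }

  reachable-⊥ : Reachable f ⊥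
  reachable-⊥ = chain 0 (∣⊥∣≡0 n) (λ _ → ⊥) refl refl (λ ()) (λ ())

  reachable-⁅x⁆ : ∀ {x} → f ⊥ < f ⁅ x ⁆ → Reachable f ⁅ x ⁆
  reachable-⁅x⁆ {x} f⊥<f⁅x⁆ = chain 1 (∣⁅x⁆∣≡1 x) C refl refl
    (λ { Fin.zero → (λ x∈⊥ → ⊥-elim (∉⊥ x∈⊥)) , x , x∈⁅x⁆ x , ∉⊥ })
    (λ { Fin.zero → f⊥<f⁅x⁆ })
    where
    C : Fin 2 → Subset n
    C Fin.zero    = ⊥
    C (Fin.suc _) = ⁅ x ⁆

  chain-index≤f : ∀ k (C : Fin (suc k) → Subset n)
                → (∀ i → f (C (inject₁ i)) < f (C (Fin.suc i)))
                → ∀ i → toℕ i ≤ f (C i)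
  chain-index≤f _       C incr Fin.zero    = z≤n
  chain-index≤f (suc k) C incr (Fin.suc i) =
    ≤-trans (s≤s (chain-index≤f k (C ∘ inject₁) (incr ∘ inject₁) i)) (incr i)

  reachable⇒∣X∣≤f : ∀ {X} → Reachable f X → ∣ X ∣ ≤ f X
  reachable⇒∣X∣≤f {X} ch =
    subst₂ _≤_ (toℕ-fromℕ ∣ X ∣) (cong f (Chain.finish ch))
      (chain-index≤f ∣ X ∣ (Chain.C ch) (Chain.incr ch) (fromℕ ∣ X ∣))

  unreachable-⁅x⁆⇒f⁅x⁆≤f⊥ : ∀ {x} → Unreachable f ⁅ x ⁆ → f ⁅ x ⁆ ≤ f ⊥
  unreachable-⁅x⁆⇒f⁅x⁆≤f⊥ unr = ≮⇒≥ (unr ∘ reachable-⁅x⁆)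

  minimalUnreachable⇒Nonempty : ∀ {U} → MinimalUnreachable f U → Nonempty U
  minimalUnreachable⇒Nonempty {U} (unr , _) with nonempty? U
  ... | yes ne = ne
  ... | no ¬ne = ⊥-elim (unr (subst (Reachable f) (sym (Empty-unique ¬ne)) reachable-⊥))

  minimalUnreachable⇒∣U∣≤1+f : ∀ {U x} → MinimalUnreachable f U → x ∈ U
                              → ∣ U ∣ ≤ suc (f (U - x))
  minimalUnreachable⇒∣U∣≤1+f {U} {x} (_ , minimal) x∈U =
    ≤-trans (∣p∣≤1+∣p-x∣ U x) (s≤s (reachable⇒∣X∣≤f (minimal (U - x) (x∈p⇒p-x⊂p x∈U))))

¬¬-∀-Subset : ∀ {n} {P : Subset n → Set} → (∀ p → ¬ ¬ P p) → ¬ ¬ (∀ p → P p)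
¬¬-∀-Subset {zero}  ¬¬P ¬∀P = ¬¬P [] (λ P[] → ¬∀P λ { [] → P[] })
¬¬-∀-Subset {suc n} ¬¬P ¬∀P =
  ¬¬-∀-Subset (λ p → ¬¬P (inside ∷ p)) λ ∀Pinside →
  ¬¬-∀-Subset (λ p → ¬¬P (outside ∷ p)) λ ∀Poutside →
  ¬∀P λ { (inside ∷ p) → ∀Pinside p ; (outside ∷ p) → ∀Poutside p }

module _ {n : ℕ} {f : Subset n → ℕ} {I : Subset n} (indep : IndependentOfMU f I) where

  -- An unreachable X ⊆ I whose proper subsets are all reachable would be a
  -- member of 𝒰 inside I. Reachability is not decidable, hence the double negation.
  ⊆-independent⇒¬¬reachable : ∀ X → X ⊆ I → ¬ ¬ Reachable f X
  ⊆-independent⇒¬¬reachable X = go (suc ∣ X ∣) X ≤-refl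
    where
    go : ∀ bound X → ∣ X ∣ < bound → X ⊆ I → ¬ ¬ Reachable f X
    go (suc bound) X (s≤s ∣X∣≤bound) X⊆I unr =
      ¬¬-∀-Subset
        (λ Y ¬P → ¬P λ Y⊂X → ⊥-elim
          (go bound Y (<-≤-trans (p⊂q⇒∣p∣<∣q∣ Y⊂X) ∣X∣≤bound) (⊆-trans (proj₁ Y⊂X) X⊆I)
            λ reach → ¬P λ _ → reach))
        (λ minimal → indep X (unr , minimal) X⊆I)

  independent⇒∣I∣≤f : ∣ I ∣ ≤ f I
  independent⇒∣I∣≤f = decidable-stable (∣ I ∣ ≤? f I) λ ∣I∣≰f →
    ⊆-independent⇒¬¬reachable I ⊆-refl (∣I∣≰f ∘ reachable⇒∣X∣≤f)

lemma9 : (n d : ℕ) (f : Subset n → ℕ)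
         → (∀ X → f X ≤ d)
         → Posimodular f
         → f ⊥ ≡ 0
         → ((∀ U → MinimalUnreachable f U → (1 ≤ ∣ U ∣) × (∣ U ∣ ≤ d + 1))
           × (∀ I → IndependentOfMU f I → ∣ I ∣ ≤ d)
           × (∀ u → MinimalUnreachable f ⁅ u ⁆
                  → (f ⁅ u ⁆ ≡ 0) × (∀ X → Nonempty X → f ⁅ u ⁆ ≤ f X)))
lemma9 n d f f≤d _ f⊥≡0 = minimal-size , independent-size , singleton-min
  where
  minimal-size : ∀ U → MinimalUnreachable f U → (1 ≤ ∣ U ∣) × (∣ U ∣ ≤ d + 1)
  minimal-size U minU with minimalUnreachable⇒Nonempty minU
  ... | x , x∈U = ≤-trans (s≤s z≤n) (x∈p⇒∣p-x∣<∣p∣ x∈U)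
                , subst (∣ U ∣ ≤_) (+-comm 1 d)
                    (≤-trans (minimalUnreachable⇒∣U∣≤1+f minU x∈U) (s≤s (f≤d (U - x))))

  independent-size : ∀ I → IndependentOfMU f I → ∣ I ∣ ≤ d
  independent-size I indep = ≤-trans (independent⇒∣I∣≤f indep) (f≤d I)

  singleton-min : ∀ u → MinimalUnreachable f ⁅ u ⁆
                → (f ⁅ u ⁆ ≡ 0) × (∀ X → Nonempty X → f ⁅ u ⁆ ≤ f X)
  singleton-min u (unr , _) = f⁅u⁆≡0 , λ X _ → subst (_≤ f X) (sym f⁅u⁆≡0) z≤n
    where
    f⁅u⁆≡0 : f ⁅ u ⁆ ≡ 0
    f⁅u⁆≡0 = n≤0⇒n≡0 (subst (f ⁅ u ⁆ ≤_) f⊥≡0 (unreachable-⁅x⁆⇒f⁅x⁆≤f⊥ unr))
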